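{- Let $m=(m_1,m_2,m_3,m_3)$ be a balanced multiplicity with $m_1,m_2\in2\mathbb{Z}+1$ and $|m|\in4\mathbb{Z}$. Then for each $i=1,2,3,4$, $\alpha_i$ does not divide $\theta_m$ (i.e. $\theta_m\notin\alpha_i\,\mathrm{Der}(S)$).
   Context: Let $\mathbb{K}$ be a field of characteristic zero, $S=\mathbb{K}[x,y]$, and $\mathrm{Der}(S)=\{f\partial_x+g\partial_y : f,g\in S\}$. Put $\alpha_1=x$, $\alpha_2=y$, $\alpha_3=x-y$, $\alpha_4=x+y$. For $m=(m_1,m_2,m_3,m_4)\in\mathbb{Z}_{\ge0}^4$ let $|m|=\sum m_i$; $m$ is balanced if $2m_i\le|m|-1$ for all $i$. For real $a$ and integer $n\ge0$ let $\langle a\rangle_n=\prod_{j=0}^{n-1}(a+2j)$ (with $\langle a\rangle_0=1$); $n!!$ is the double factorial with $0!!=1$. For $m=(m_1,m_2,m_3,m_3)$ with $m_1,m_2$ odd and $|m|\in4\mathbb{Z}$, let $d=\frac{|m|}{2}-1$ and define $f_m=\sum_{i=0}^{(d-m_1)/2}(-1)^i\frac{\langle m_1+m_2-d\rangle_{(d-m_1)/2-i}}{(d-m_1-2i)!!\,(d-2i)!!\,(2i)!!}x^{d-2i}y^{2i}$, $g_m=\sum_{i=0}^{(d-m_2)/2}(-1)^{i+m_3}\frac{\langle m_1+m_2-d\rangle_{(d-m_2)/2-i}}{(d-m_2-2i)!!\,(d-2i)!!\,(2i)!!}x^{2i}y^{d-2i}$, where a sum with negative upper limit is $0$, and $\theta_m=f_m\partial_x-g_m\partial_y$.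 -}

module Defs where

open import Level using (Level; _⊔_) renaming (suc to lsuc)
open import Algebra.Bundles using (CommutativeRing)
open import Data.Nat as ℕ using (ℕ; zero; suc; _∸_; ⌊_/2⌋; _≤_; _≟_)
open import Data.Nat.Properties using (m*n≡0⇒m≡0∨n≡0)
open import Data.Integer as ℤ using (ℤ; +_; -[1+_])
open import Data.List using (List; []; _∷_; map; foldr; upTo)
open import Data.Product using (Σ; _×_; _,_; ∃)
import Data.Product
open import Data.Sum using (inj₁; inj₂)
open import Data.Fin using (Fin)
open import Relation.Nullary using (¬_; yes; no)
open import Relation.Binary.PropositionalEquality as P using (_≡_; _≢_)
open import Data.Empty using (⊥-elim)
open import Data.Nat.Properties using (<-irrefl)

record Field (c ℓ : Level) : Set (lsuc (c ⊔ ℓ)) where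
  field
    commutativeRing : CommutativeRing c ℓ
  open CommutativeRing commutativeRing public
  field
    1≉0     : ¬ (1# ≈ 0#)
    inverse : ∀ x → ¬ (x ≈ 0#) → Σ Carrier (λ y → x * y ≈ 1#)

module FieldOps {c ℓ} (F : Field c ℓ) where
  open Field F

  ℕ→F : ℕ → Carrier
  ℕ→F zero    = 0#
  ℕ→F (suc n) = 1# + ℕ→F n

  ℤ→F : ℤ → Carrier
  ℤ→F (+ n)      = ℕ→F n
  ℤ→F -[1+ n ]   = - ℕ→F (suc n)

CharZero : ∀ {c ℓ} → Field c ℓ → Set ℓ
CharZero F = ∀ n → ℕ→F n ≈ 0# → n ≡ 0
  where open Field F
        open FieldOps F

_!! : ℕ → ℕ
zero !!          = 1
suc zero !!      = 1
suc (suc n) !!   = suc (suc n) ℕ.* (n !!)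

!!≢0 : ∀ n → n !! ≢ 0
!!≢0 zero ()
!!≢0 (suc zero) ()
!!≢0 (suc (suc n)) eq with m*n≡0⇒m≡0∨n≡0 (suc (suc n)) eq
... | inj₁ ()
... | inj₂ e = !!≢0 n e

⟨_⟩ : ℤ → ℕ → ℤ
⟨ a ⟩ zero    = + 1
⟨ a ⟩ (suc n) = ⟨ a ⟩ n ℤ.* (a ℤ.+ + (2 ℕ.* n))

sgn : ℕ → ℤ
sgn zero = + 1
sgn (suc k) = ℤ.- sgn k

module Poly {c ℓ} (F : Field c ℓ) where
  open Field F
  open FieldOps F

  ∑ : List ℕ → (ℕ → Carrier) → Carrier
  ∑ l f = foldr (λ i acc → f i + acc) 0# l

  -- A polynomial: coefficient of x^a y^b, with finite support
  record S : Set (c ⊔ ℓ) where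
    constructor poly
    field
      coeff   : ℕ → ℕ → Carrier
      bound   : ℕ
      support : ∀ a b → bound ℕ.< a ℕ.+ b → coeff a b ≈ 0#
  open S public

  _≈S_ : S → S → Set ℓ
  p ≈S q = ∀ a b → coeff p a b ≈ coeff q a b

  0S : S
  0S = poly (λ _ _ → 0#) 0 (λ _ _ _ → Field.refl F)

  mono : Carrier → ℕ → ℕ → S
  mono k i j = poly cf (i ℕ.+ j) sup
    where
      cf : ℕ → ℕ → Carrier
      cf a b with a ≟ i | b ≟ j
      ... | yes _ | yes _ = k
      ... | _     | _     = 0#
      sup : ∀ a b → i ℕ.+ j ℕ.< a ℕ.+ b → cf a b ≈ 0#
      sup a b lt with a ≟ i | b ≟ j
      ... | yes P.refl | yes P.refl = ⊥-elim (<-irrefl P.refl lt)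
      ... | yes _ | no _ = refl
      ... | no _  | _    = refl

  _+S_ : S → S → S
  p +S q = poly (λ a b → coeff p a b + coeff q a b) (bound p ℕ.+ bound q) sup
    where
      open import Data.Nat.Properties using (≤-<-trans; m≤m+n; m≤n+m)
      open import Relation.Binary.Reasoning.Setoid setoid
      sup : ∀ a b → bound p ℕ.+ bound q ℕ.< a ℕ.+ b → coeff p a b + coeff q a b ≈ 0#
      sup a b lt = begin
        coeff p a b + coeff q a b
          ≈⟨ +-cong (support p a b (≤-<-trans (m≤m+n (bound p) (bound q)) lt))
                    (support q a b (≤-<-trans (m≤n+m (bound q) (bound p)) lt)) ⟩
        0# + 0#  ≈⟨ +-identityˡ 0# ⟩
        0# ∎

  -S_ : S → S
  -S p = poly (λ a b → - coeff p a b) (bound p)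
              (λ a b lt → trans (-‿cong (support p a b lt)) (sym (-0≈0)))
    where
      open import Algebra.Properties.Ring ring using (-0#≈0#)
      -0≈0 : 0# ≈ - 0#
      -0≈0 = sym -0#≈0#

  mulCoeff : S → S → ℕ → ℕ → Carrier
  mulCoeff p q a b =
    ∑ (upTo (suc a)) (λ i → ∑ (upTo (suc b)) (λ j →
        coeff p i j * coeff q (a ∸ i) (b ∸ j)))

  -- Der(S) = { f ∂x + g ∂y }, represented by the pair (f , g)
  Der : Set (c ⊔ ℓ)
  Der = S × S

  _∈_·Der : Der → S → Set (c ⊔ ℓ)
  (f , g) ∈ α ·Der = Σ S λ q₁ → Σ S λ q₂ →
    (∀ a b → coeff f a b ≈ mulCoeff α q₁ a b) ×
    (∀ a b → coeff g a b ≈ mulCoeff α q₂ a b)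

  xS yS : S
  xS = mono 1# 1 0
  yS = mono 1# 0 1

  α : Fin 4 → S
  α Fin.zero                         = xS
  α (Fin.suc Fin.zero)               = yS
  α (Fin.suc (Fin.suc Fin.zero))     = xS +S (-S yS)
  α (Fin.suc (Fin.suc (Fin.suc Fin.zero))) = xS +S yS

Multiplicity : Set
Multiplicity = Fin 4 → ℕ

m₁ m₂ m₃ m₄ : Multiplicity → ℕ
m₁ m = m Fin.zero
m₂ m = m (Fin.suc Fin.zero)
m₃ m = m (Fin.suc (Fin.suc Fin.zero))
m₄ m = m (Fin.suc (Fin.suc (Fin.suc Fin.zero)))

∣_∣ₘ : Multiplicity → ℕ
∣ m ∣ₘ = m₁ m ℕ.+ m₂ m ℕ.+ m₃ m ℕ.+ m₄ m

-- balanced: 2 mᵢ ≤ |m| - 1 for all i  (over ℤ; equivalently 2 mᵢ + 1 ≤ |m| in ℕ)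
Balanced : Multiplicity → Set
Balanced m = ∀ i → 2 ℕ.* m i ℕ.+ 1 ≤ ∣ m ∣ₘ

private
  prod≢0 : ∀ a b c → a !! ≢ 0 → b !! ≢ 0 → c !! ≢ 0 → a !! ℕ.* b !! ℕ.* c !! ≢ 0
  prod≢0 a b c ha hb hc e with m*n≡0⇒m≡0∨n≡0 (a !! ℕ.* b !! ) e
  ... | inj₂ e′ = hc e′
  ... | inj₁ e′ with m*n≡0⇒m≡0∨n≡0 (a !!) e′
  ... | inj₁ e″ = ha e″
  ... | inj₂ e″ = hb e″

module Theta {c ℓ} (F : Field c ℓ) (char0 : CharZero F) where
  open Field F
  open FieldOps F
  open Poly F

  frac : ℤ → ℕ → ℕ → ℕ → Carrier
  frac num a b c = ℤ→F num * Data.Product.proj₁ (inverse (ℕ→F den) nz)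
    where
      den = a !! ℕ.* b !! ℕ.* c !!
      nz : ¬ (ℕ→F den ≈ 0#)
      nz e = prod≢0 a b c (!!≢0 a) (!!≢0 b) (!!≢0 c) (char0 den e)

  ∑S : ℕ → (ℕ → S) → S
  ∑S U t = foldr (λ i acc → t i +S acc) 0S (upTo (suc U))

  module _ (m : Multiplicity) where
    d : ℕ
    d = ⌊ ∣ m ∣ₘ /2⌋ ∸ 1

    a₀ : ℤ
    a₀ = + (m₁ m ℕ.+ m₂ m) ℤ.- + d

    U₁ U₂ : ℕ
    U₁ = ⌊ d ∸ m₁ m /2⌋
    U₂ = ⌊ d ∸ m₂ m /2⌋

    f : S
    f = ∑S U₁ (λ i →
          mono (frac (sgn i ℤ.* ⟨ a₀ ⟩ (U₁ ∸ i))
                     (d ∸ m₁ m ∸ 2 ℕ.* i) (d ∸ 2 ℕ.* i) (2 ℕ.* i))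
               (d ∸ 2 ℕ.* i) (2 ℕ.* i))

    g : S
    g = ∑S U₂ (λ i →
          mono (frac (sgn (i ℕ.+ m₃ m) ℤ.* ⟨ a₀ ⟩ (U₂ ∸ i))
                     (d ∸ m₂ m ∸ 2 ℕ.* i) (d ∸ 2 ℕ.* i) (2 ℕ.* i))
               (2 ℕ.* i) (d ∸ 2 ℕ.* i))

    θ : Der
    θ = f , (-S g)

-- Writing d = |m|/2 − 1, n = (d − m₁)/2 and a₀ = m₁ + m₂ − d, the polynomial f_m is
-- homogeneous of degree d with only even powers of y, and a₀ + 2j is odd for every j
-- because m₂ is odd and d − m₁ is even.
-- If x divides θ_m it divides g_m, whose y^d coefficient is ±⟨a₀⟩_{(d−m₂)/2} / (…) ≠ 0;
-- symmetrically for y and the x^d coefficient of f_m.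
-- If x ∓ y divides θ_m, then f_m(1, ±1) = 0.  But f_m(1, ±1) is the plain sum of the
-- coefficients of f_m, and after multiplying by (2n)!! d!! it becomes the Chu–Vandermonde sum
--   Σ_{i+j=n} C(n,i) (−1)^i ⟨a₀⟩_j ⟨m₁ + 2 + 2j⟩_i = (−1)^n ⟨m₁ + 2 − a₀⟩_n,
-- a product of the positive integers d − m₂ + 2, d − m₂ + 4, …, which is nonzero in characteristic 0.

module Submission where

open import Defs
open import Data.Fin using (Fin; toℕ)
open import Data.Nat using (ℕ; zero; suc; _∸_; _≤_; _<_; z≤n; s≤s; ⌊_/2⌋)
open import Data.Nat.Divisibility using (_∣_)
open import Data.Integer using (ℤ; +_; -[1+_])
open import Data.Product using (Σ; _,_; proj₁; ∃-syntax)
open import Data.Sum using (_⊎_; inj₁; inj₂)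
open import Data.Empty using (⊥)
open import Relation.Nullary using (¬_; contradiction; yes; no)
open import Relation.Binary.PropositionalEquality as ≡ using (_≡_; _≢_)

module _ where
  open import Data.Nat using (_+_; _*_)
  open import Relation.Binary.PropositionalEquality using (refl; sym; trans; cong; cong₂; module ≡-Reasoning)
  open import Data.Nat.Properties
  open import Data.Nat.Divisibility using (divides; ∣m+n∣m⇒∣n)
  open import Data.Nat.Tactic.RingSolver using (solve-∀)
  open ≡-Reasoning

  2*suc : ∀ k → 2 * suc k ≡ suc (suc (2 * k))
  2*suc = solve-∀

  !!-2*suc : ∀ k → (2 * suc k) !! ≡ 2 * suc k * (2 * k) !!
  !!-2*suc k = trans (cong _!! (2*suc k)) (cong (_* (2 * k) !!) (sym (2*suc k)))

  -- binomial i j = C(i + j, i)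
  binomial : ℕ → ℕ → ℕ
  binomial zero    j       = 1
  binomial (suc i) zero    = 1
  binomial (suc i) (suc j) = binomial i (suc j) + binomial (suc i) j

  !!-binomial : ∀ i j → (2 * i) !! * (2 * j) !! * binomial i j ≡ (2 * (i + j)) !!
  !!-binomial zero    j       = trans (*-identityʳ _) (+-identityʳ _)
  !!-binomial (suc i) zero    = trans (*-identityʳ _) (trans (*-identityʳ _) (cong (λ k → (2 * k) !!) (sym (+-identityʳ (suc i)))))
  !!-binomial (suc i) (suc j) = begin
    (2 * suc i) !! * (2 * suc j) !! * (binomial i (suc j) + binomial (suc i) j)
      ≡⟨ *-distribˡ-+ ((2 * suc i) !! * (2 * suc j) !!) _ _ ⟩
    (2 * suc i) !! * (2 * suc j) !! * binomial i (suc j) + (2 * suc i) !! * (2 * suc j) !! * binomial (suc i) j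
      ≡⟨ cong₂ _+_
           (trans (cong (λ u → u * (2 * suc j) !! * binomial i (suc j)) (!!-2*suc i))
                  (regroupˡ (2 * suc i) ((2 * i) !!) ((2 * suc j) !!) (binomial i (suc j))))
           (trans (cong (λ u → (2 * suc i) !! * u * binomial (suc i) j) (!!-2*suc j))
                  (regroupʳ (2 * suc j) ((2 * suc i) !!) ((2 * j) !!) (binomial (suc i) j))) ⟩
    2 * suc i * ((2 * i) !! * (2 * suc j) !! * binomial i (suc j)) + 2 * suc j * ((2 * suc i) !! * (2 * j) !! * binomial (suc i) j)
      ≡⟨ cong₂ (λ u v → 2 * suc i * u + 2 * suc j * v)
               (trans (!!-binomial i (suc j)) (cong (λ k → (2 * k) !!) (+-suc i j))) (!!-binomial (suc i) j) ⟩
    2 * suc i * (2 * suc (i + j)) !! + 2 * suc j * (2 * suc (i + j)) !!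
      ≡⟨ collect i j ((2 * suc (i + j)) !!) ⟩
    2 * suc (suc (i + j)) * (2 * suc (i + j)) !!
      ≡⟨ sym (!!-2*suc (suc (i + j))) ⟩
    (2 * suc (suc (i + j))) !!
      ≡⟨ cong (λ k → (2 * suc k) !!) (sym (+-suc i j)) ⟩
    (2 * (suc i + suc j)) !! ∎
    where
    regroupˡ : ∀ a x y b → a * x * y * b ≡ a * (x * y * b)
    regroupˡ = solve-∀
    regroupʳ : ∀ a x y b → x * (a * y) * b ≡ a * (x * y * b)
    regroupʳ = solve-∀
    collect : ∀ i j w → 2 * suc i * w + 2 * suc j * w ≡ 2 * suc (suc (i + j)) * w
    collect = solve-∀

  even⊎odd : ∀ n → 2 ∣ n ⊎ ∃[ p ] n ≡ suc (2 * p)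
  even⊎odd zero    = inj₁ (divides 0 refl)
  even⊎odd (suc n) with even⊎odd n
  ... | inj₁ (divides p refl) = inj₂ (p , cong suc (*-comm p 2))
  ... | inj₂ (p , refl)      = inj₁ (divides (suc p) (trans (sym (2*suc p)) (*-comm 2 (suc p))))

  ¬2∣⇒odd : ∀ {n} → ¬ 2 ∣ n → ∃[ p ] n ≡ suc (2 * p)
  ¬2∣⇒odd {n} ¬2∣n with even⊎odd n
  ... | inj₁ 2∣n = contradiction 2∣n ¬2∣n
  ... | inj₂ odd = odd

  odd+even≢even : ∀ {m} j n → ¬ 2 ∣ m → m + 2 * j ≢ 2 * n
  odd+even≢even {m} j n m-odd eq =
    m-odd (∣m+n∣m⇒∣n (divides n (trans (+-comm (2 * j) m) (trans eq (*-comm 2 n)))) (divides j (*-comm 2 j)))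

  ⌊n*4/2⌋≡2*n : ∀ n → ⌊ n * 4 /2⌋ ≡ 2 * n
  ⌊n*4/2⌋≡2*n n = trans (cong ⌊_/2⌋ (double n)) (sym (n≡⌊n+n/2⌋ (2 * n)))
    where
    double : ∀ n → n * 4 ≡ 2 * n + 2 * n
    double = solve-∀

  ⌊4K/2⌋∸1≡odd+even : ∀ K p → 2 * suc (2 * p) + 1 ≤ K * 4 → ∃[ r ] ⌊ K * 4 /2⌋ ∸ 1 ≡ suc (2 * p) + 2 * r
  ⌊4K/2⌋∸1≡odd+even K p 4p+3≤4K with m≤n⇒∃[o]m+o≡n p<K
    where
    p<K : p < K
    p<K = *-cancelʳ-< 4 p K (≤-trans (≤-trans (m≤m+n (suc (p * 4)) 2) (≤-reflexive (4p+3 p))) 4p+3≤4K)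
      where
      4p+3 : ∀ p → suc (p * 4) + 2 ≡ 2 * suc (2 * p) + 1
      4p+3 = solve-∀
  ... | r , refl = r , (begin
    ⌊ (suc p + r) * 4 /2⌋ ∸ 1 ≡⟨ cong (_∸ 1) (trans (⌊n*4/2⌋≡2*n (suc p + r)) (2*suc (p + r))) ⟩
    suc (2 * (p + r))         ≡⟨ regroup p r ⟩
    suc (2 * p) + 2 * r       ∎)
    where
    regroup : ∀ p r → suc (2 * (p + r)) ≡ suc (2 * p) + 2 * r
    regroup = solve-∀

  ≡+2*⌊∸/2⌋ : ∀ {d m} r → d ≡ m + 2 * r → d ≡ m + 2 * ⌊ (d ∸ m) /2⌋
  ≡+2*⌊∸/2⌋ {m = m} r refl = cong (λ k → m + 2 * k) (sym (begin
    ⌊ m + 2 * r ∸ m /2⌋ ≡⟨ cong ⌊_/2⌋ (trans (m+n∸m≡n m (2 * r)) (cong (λ k → r + k) (+-identityʳ r))) ⟩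
    ⌊ r + r /2⌋         ≡⟨ sym (n≡⌊n+n/2⌋ r) ⟩
    r ∎))

  4∣n⇒⌊n/2⌋∸1≡odd+even : ∀ {n x} → 4 ∣ n → ¬ 2 ∣ x → 2 * x + 1 ≤ n →
                          ⌊ n /2⌋ ∸ 1 ≡ x + 2 * ⌊ (⌊ n /2⌋ ∸ 1 ∸ x) /2⌋
  4∣n⇒⌊n/2⌋∸1≡odd+even (divides K refl) x-odd 2x+1≤n with ¬2∣⇒odd x-odd
  ... | p , refl with ⌊4K/2⌋∸1≡odd+even K p 2x+1≤n
  ... | r , eq = ≡+2*⌊∸/2⌋ {m = suc (2 * p)} r eq

module _ where
  import Data.Nat as ℕ
  open import Relation.Binary.PropositionalEquality using (refl; sym; trans; cong; cong₂; module ≡-Reasoning)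
  import Data.Nat.Properties as ℕₚ
  import Data.Nat.Tactic.RingSolver as ℕ-Solver
  open import Data.Integer using (_+_; _*_; -_; _-_)
  open import Data.Integer.Properties
  open import Data.Integer.Tactic.RingSolver using (solve-∀)
  open ≡-Reasoning

  antidiagonal : ℕ → (ℕ → ℕ → ℤ) → ℤ
  antidiagonal zero    h = h 0 0
  antidiagonal (suc n) h = h 0 (suc n) + antidiagonal n (λ i j → h (suc i) j)

  antidiagonal-cong : ∀ n {h h′} → (∀ i j → i ℕ.+ j ≡ n → h i j ≡ h′ i j) →
                      antidiagonal n h ≡ antidiagonal n h′
  antidiagonal-cong zero    h≡h′ = h≡h′ 0 0 refl
  antidiagonal-cong (suc n) h≡h′ =
    cong₂ _+_ (h≡h′ 0 (suc n) refl) (antidiagonal-cong n (λ i j i+j≡n → h≡h′ (suc i) j (cong suc i+j≡n)))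

  antidiagonal-+ : ∀ n h h′ → antidiagonal n (λ i j → h i j + h′ i j) ≡ antidiagonal n h + antidiagonal n h′
  antidiagonal-+ zero    h h′ = refl
  antidiagonal-+ (suc n) h h′ = trans (cong (λ s → h 0 (suc n) + h′ 0 (suc n) + s) (antidiagonal-+ n _ _))
                                      (interchange (h 0 (suc n)) (h′ 0 (suc n)) _ _)
    where
    interchange : ∀ a b c d → a + b + (c + d) ≡ a + c + (b + d)
    interchange = solve-∀

  antidiagonal-*ˡ : ∀ n c h → antidiagonal n (λ i j → c * h i j) ≡ c * antidiagonal n h
  antidiagonal-*ˡ zero    c h = refl
  antidiagonal-*ˡ (suc n) c h = trans (cong (λ s → c * h 0 (suc n) + s) (antidiagonal-*ˡ n c _))
                                      (sym (*-distribˡ-+ c _ _))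

  antidiagonal-suc : ∀ n h → antidiagonal (suc n) h ≡ antidiagonal n (λ i j → h i (suc j)) + h (suc n) 0
  antidiagonal-suc zero    h = refl
  antidiagonal-suc (suc n) h = trans (cong (λ s → h 0 (suc (suc n)) + s) (antidiagonal-suc n (λ i j → h (suc i) j)))
                                     (sym (+-assoc (h 0 (suc (suc n))) _ _))

  antidiagonal-pascal : ∀ n (h : ℕ → ℕ → ℤ) →
    antidiagonal (suc n) (λ i j → + binomial i j * h i j) ≡
    antidiagonal n (λ i j → + binomial i j * h i (suc j)) + antidiagonal n (λ i j → + binomial i j * h (suc i) j)
  antidiagonal-pascal zero    h = refl
  antidiagonal-pascal (suc n) h = begin
    first + antidiagonal (suc n) (λ i j → + binomial (suc i) j * h (suc i) j)
      ≡⟨ cong (λ s → first + s) (antidiagonal-suc n (λ i j → + binomial (suc i) j * h (suc i) j)) ⟩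
    first + (antidiagonal n (λ i j → + (binomial i (suc j) ℕ.+ binomial (suc i) j) * h (suc i) (suc j)) + last)
      ≡⟨ cong (λ s → first + (s + last)) (trans (antidiagonal-cong n (λ i j _ → split i j))
                                                                (antidiagonal-+ n (λ i j → + binomial i (suc j) * h (suc i) (suc j))
                                                                                  (λ i j → + binomial (suc i) j * h (suc i) (suc j)))) ⟩
    first + ((P + Q) + last)
      ≡⟨ regroup first P Q last ⟩
    (first + Q) + (P + last)
      ≡⟨ cong (λ s → (first + Q) + s) (sym (antidiagonal-suc n (λ i j → + binomial i j * h (suc i) j))) ⟩
    (first + Q) + antidiagonal (suc n) (λ i j → + binomial i j * h (suc i) j) ∎
    where
    first last P Q : ℤ
    first = + 1 * h 0 (suc (suc n))
    last  = + 1 * h (suc (suc n)) 0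
    P = antidiagonal n (λ i j → + binomial i (suc j) * h (suc i) (suc j))
    Q = antidiagonal n (λ i j → + binomial (suc i) j * h (suc i) (suc j))
    split : ∀ i j → + (binomial i (suc j) ℕ.+ binomial (suc i) j) * h (suc i) (suc j) ≡
                    + binomial i (suc j) * h (suc i) (suc j) + + binomial (suc i) j * h (suc i) (suc j)
    split i j = *-distribʳ-+ (h (suc i) (suc j)) (+ binomial i (suc j)) (+ binomial (suc i) j)
    regroup : ∀ a p q b → a + ((p + q) + b) ≡ (a + q) + (p + b)
    regroup = solve-∀

  +2*suc : ∀ k → + (2 ℕ.* suc k) ≡ + 2 + + (2 ℕ.* k)
  +2*suc k = cong +_ (2*suc k)

  ⟨⟩-suc : ∀ a k → ⟨ a ⟩ (suc k) ≡ a * ⟨ a + + 2 ⟩ k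
  ⟨⟩-suc a zero    = unit a
    where
    unit : ∀ a → + 1 * (a + + 0) ≡ a * + 1
    unit = solve-∀
  ⟨⟩-suc a (suc k) = begin
    ⟨ a ⟩ (suc k) * (a + + (2 ℕ.* suc k))
      ≡⟨ cong₂ _*_ (⟨⟩-suc a k) (cong (λ t → a + t) (+2*suc k)) ⟩
    a * ⟨ a + + 2 ⟩ k * (a + (+ 2 + + (2 ℕ.* k)))
      ≡⟨ regroup a (⟨ a + + 2 ⟩ k) (+ 2) (+ (2 ℕ.* k)) ⟩
    a * (⟨ a + + 2 ⟩ k * (a + + 2 + + (2 ℕ.* k))) ∎
    where
    regroup : ∀ a p c t → a * p * (a + (c + t)) ≡ a * (p * (a + c + t))
    regroup = solve-∀

  vandermondeSum : ℕ → ℤ → ℤ → ℤ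
  vandermondeSum n a b = antidiagonal n (λ i j → + binomial i j * (sgn i * ⟨ a ⟩ j * ⟨ b + + (2 ℕ.* j) ⟩ i))

  vandermondeSum-suc : ∀ n a b → vandermondeSum (suc n) a b ≡
    a * vandermondeSum n (a + + 2) (b + + 2) + - (b + + (2 ℕ.* n)) * vandermondeSum n a b
  vandermondeSum-suc n a b = begin
    vandermondeSum (suc n) a b
      ≡⟨ antidiagonal-pascal n term ⟩
    antidiagonal n (λ i j → + binomial i j * term i (suc j)) + antidiagonal n (λ i j → + binomial i j * term (suc i) j)
      ≡⟨ cong₂ _+_ (trans (antidiagonal-cong n (λ i j _ → raise-j i j)) (antidiagonal-*ˡ n a _))
                   (trans (antidiagonal-cong n raise-i) (antidiagonal-*ˡ n (- (b + + (2 ℕ.* n))) _)) ⟩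
    a * vandermondeSum n (a + + 2) (b + + 2) + - (b + + (2 ℕ.* n)) * vandermondeSum n a b ∎
    where
    term : ℕ → ℕ → ℤ
    term i j = sgn i * ⟨ a ⟩ j * ⟨ b + + (2 ℕ.* j) ⟩ i
    raise-j : ∀ i j → + binomial i j * term i (suc j) ≡
                      a * (+ binomial i j * (sgn i * ⟨ a + + 2 ⟩ j * ⟨ b + + 2 + + (2 ℕ.* j) ⟩ i))
    raise-j i j = begin
      + binomial i j * (sgn i * ⟨ a ⟩ (suc j) * ⟨ b + + (2 ℕ.* suc j) ⟩ i)
        ≡⟨ cong₂ (λ u v → + binomial i j * (sgn i * u * ⟨ v ⟩ i)) (⟨⟩-suc a j)
                 (trans (cong (λ t → b + t) (+2*suc j)) (sym (+-assoc b (+ 2) _))) ⟩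
      + binomial i j * (sgn i * (a * ⟨ a + + 2 ⟩ j) * ⟨ b + + 2 + + (2 ℕ.* j) ⟩ i)
        ≡⟨ regroup (+ binomial i j) (sgn i) a (⟨ a + + 2 ⟩ j) (⟨ b + + 2 + + (2 ℕ.* j) ⟩ i) ⟩
      a * (+ binomial i j * (sgn i * ⟨ a + + 2 ⟩ j * ⟨ b + + 2 + + (2 ℕ.* j) ⟩ i)) ∎
      where
      regroup : ∀ c s a p q → c * (s * (a * p) * q) ≡ a * (c * (s * p * q))
      regroup = solve-∀
    raise-i : ∀ i j → i ℕ.+ j ≡ n → + binomial i j * term (suc i) j ≡ - (b + + (2 ℕ.* n)) * (+ binomial i j * term i j)
    raise-i i j i+j≡n = begin
      + binomial i j * (- sgn i * ⟨ a ⟩ j * (⟨ b + + (2 ℕ.* j) ⟩ i * (b + + (2 ℕ.* j) + + (2 ℕ.* i))))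
        ≡⟨ cong (λ c → + binomial i j * (- sgn i * ⟨ a ⟩ j * (⟨ b + + (2 ℕ.* j) ⟩ i * c))) last-factor ⟩
      + binomial i j * (- sgn i * ⟨ a ⟩ j * (⟨ b + + (2 ℕ.* j) ⟩ i * (b + + (2 ℕ.* n))))
        ≡⟨ regroup (+ binomial i j) (sgn i) (⟨ a ⟩ j) (⟨ b + + (2 ℕ.* j) ⟩ i) (b + + (2 ℕ.* n)) ⟩
      - (b + + (2 ℕ.* n)) * (+ binomial i j * term i j) ∎
      where
      last-factor : b + + (2 ℕ.* j) + + (2 ℕ.* i) ≡ b + + (2 ℕ.* n)
      last-factor = trans (+-assoc b _ _)
        (cong (λ t → b + + t) (trans (sym (ℕₚ.*-distribˡ-+ 2 j i)) (cong (2 ℕ.*_) (trans (ℕₚ.+-comm j i) i+j≡n))))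
      regroup : ∀ c s a p q → c * (- s * a * (p * q)) ≡ - q * (c * (s * a * p))
      regroup = solve-∀

  vandermonde : ∀ n a b → vandermondeSum n a b ≡ sgn n * ⟨ b - a ⟩ n
  vandermonde zero    a b = refl
  vandermonde (suc n) a b = begin
    vandermondeSum (suc n) a b
      ≡⟨ vandermondeSum-suc n a b ⟩
    a * vandermondeSum n (a + + 2) (b + + 2) + - (b + + (2 ℕ.* n)) * vandermondeSum n a b
      ≡⟨ cong₂ (λ u v → a * u + - (b + + (2 ℕ.* n)) * v)
               (trans (vandermonde n (a + + 2) (b + + 2)) (cong (λ c → sgn n * ⟨ c ⟩ n) (shift b a)))
               (vandermonde n a b) ⟩
    a * (sgn n * ⟨ b - a ⟩ n) + - (b + + (2 ℕ.* n)) * (sgn n * ⟨ b - a ⟩ n)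
      ≡⟨ collect a b (sgn n) (⟨ b - a ⟩ n) (+ (2 ℕ.* n)) ⟩
    - sgn n * (⟨ b - a ⟩ n * (b - a + + (2 ℕ.* n))) ∎
    where
    shift : ∀ b a → b + + 2 - (a + + 2) ≡ b - a
    shift = solve-∀
    collect : ∀ a b s p t → a * (s * p) + - (b + t) * (s * p) ≡ - s * (p * (b - a + t))
    collect = solve-∀

  ⟨⟩≢0 : ∀ {a} → (∀ j → a + + (2 ℕ.* j) ≢ + 0) → ∀ k → ⟨ a ⟩ k ≢ + 0
  ⟨⟩≢0 factor≢0 zero    ()
  ⟨⟩≢0 factor≢0 (suc k) eq with i*j≡0⇒i≡0∨j≡0 (⟨ _ ⟩ k) eq
  ... | inj₁ eq′ = ⟨⟩≢0 factor≢0 k eq′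
  ... | inj₂ eq′ = factor≢0 k eq′

  sgn*≢0 : ∀ k {z} → z ≢ + 0 → sgn k * z ≢ + 0
  sgn*≢0 zero    z≢0 eq = z≢0 (trans (sym (*-identityˡ _)) eq)
  sgn*≢0 (suc k) z≢0 eq = sgn*≢0 k z≢0 (trans (sym (neg-involutive _)) (cong -_ (trans (neg-distribˡ-* (sgn k) _) eq)))

  pos-*³ : ∀ a b c → + (a ℕ.* b ℕ.* c) ≡ + a * + b * + c
  pos-*³ a b c = trans (pos-* (a ℕ.* b) c) (cong (_* + c) (pos-* a b))

  !!-+2* : ∀ y i → + (y ℕ.+ 2 ℕ.* i) !! ≡ + y !! * ⟨ + y + + 2 ⟩ i
  !!-+2* y zero    = trans (cong (λ k → + k !!) (ℕₚ.+-identityʳ y)) (sym (*-identityʳ _))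
  !!-+2* y (suc i) = begin
    + (y ℕ.+ 2 ℕ.* suc i) !!
      ≡⟨ cong (λ k → + k !!) (unfold y i) ⟩
    + (suc (suc (y ℕ.+ 2 ℕ.* i)) ℕ.* (y ℕ.+ 2 ℕ.* i) !!)
      ≡⟨ pos-* (suc (suc (y ℕ.+ 2 ℕ.* i))) ((y ℕ.+ 2 ℕ.* i) !!) ⟩
    + suc (suc (y ℕ.+ 2 ℕ.* i)) * + (y ℕ.+ 2 ℕ.* i) !!
      ≡⟨ cong₂ _*_ (cong +_ (reorder y i)) (!!-+2* y i) ⟩
    (+ y + + 2 + + (2 ℕ.* i)) * (+ y !! * ⟨ + y + + 2 ⟩ i)
      ≡⟨ regroup (+ y + + 2 + + (2 ℕ.* i)) (+ y !!) (⟨ + y + + 2 ⟩ i) ⟩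
    + y !! * (⟨ + y + + 2 ⟩ i * (+ y + + 2 + + (2 ℕ.* i))) ∎
    where
    unfold : ∀ y i → y ℕ.+ 2 ℕ.* suc i ≡ suc (suc (y ℕ.+ 2 ℕ.* i))
    unfold y i = trans (cong (y ℕ.+_) (2*suc i)) (trans (ℕₚ.+-suc y _) (cong suc (ℕₚ.+-suc y _)))
    reorder : ∀ y i → suc (suc (y ℕ.+ 2 ℕ.* i)) ≡ y ℕ.+ 2 ℕ.+ 2 ℕ.* i
    reorder = ℕ-Solver.solve-∀
    regroup : ∀ c x p → c * (x * p) ≡ x * (p * c)
    regroup = solve-∀

  !!-split : ∀ m i j →
    + ((2 ℕ.* j) !! ℕ.* (m ℕ.+ 2 ℕ.* j) !! ℕ.* (2 ℕ.* i) !!) * (+ binomial i j * ⟨ + (m ℕ.+ 2) + + (2 ℕ.* j) ⟩ i) ≡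
    + ((2 ℕ.* (i ℕ.+ j)) !! ℕ.* (m ℕ.+ 2 ℕ.* (i ℕ.+ j)) !!)
  !!-split m i j = sym (begin
    + ((2 ℕ.* (i ℕ.+ j)) !! ℕ.* (m ℕ.+ 2 ℕ.* (i ℕ.+ j)) !!)
      ≡⟨ pos-* ((2 ℕ.* (i ℕ.+ j)) !!) _ ⟩
    + (2 ℕ.* (i ℕ.+ j)) !! * + (m ℕ.+ 2 ℕ.* (i ℕ.+ j)) !!
      ≡⟨ cong₂ _*_ (trans (cong +_ (sym (!!-binomial i j))) (pos-*³ ((2 ℕ.* i) !!) ((2 ℕ.* j) !!) (binomial i j)))
                   (trans (cong (λ k → + k !!) (reassoc m i j)) (!!-+2* (m ℕ.+ 2 ℕ.* j) i)) ⟩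
    + (2 ℕ.* i) !! * + (2 ℕ.* j) !! * + binomial i j * (+ (m ℕ.+ 2 ℕ.* j) !! * ⟨ + (m ℕ.+ 2 ℕ.* j) + + 2 ⟩ i)
      ≡⟨ cong (λ a → + (2 ℕ.* i) !! * + (2 ℕ.* j) !! * + binomial i j * (+ (m ℕ.+ 2 ℕ.* j) !! * ⟨ a ⟩ i)) shift ⟩
    + (2 ℕ.* i) !! * + (2 ℕ.* j) !! * + binomial i j * (+ (m ℕ.+ 2 ℕ.* j) !! * ⟨ + (m ℕ.+ 2) + + (2 ℕ.* j) ⟩ i)
      ≡⟨ regroup (+ (2 ℕ.* i) !!) (+ (2 ℕ.* j) !!) (+ binomial i j) (+ (m ℕ.+ 2 ℕ.* j) !!) _ ⟩
    + (2 ℕ.* j) !! * + (m ℕ.+ 2 ℕ.* j) !! * + (2 ℕ.* i) !! * (+ binomial i j * ⟨ + (m ℕ.+ 2) + + (2 ℕ.* j) ⟩ i)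
      ≡⟨ cong (_* (+ binomial i j * ⟨ + (m ℕ.+ 2) + + (2 ℕ.* j) ⟩ i))
              (sym (pos-*³ ((2 ℕ.* j) !!) ((m ℕ.+ 2 ℕ.* j) !!) ((2 ℕ.* i) !!))) ⟩
    + ((2 ℕ.* j) !! ℕ.* (m ℕ.+ 2 ℕ.* j) !! ℕ.* (2 ℕ.* i) !!) * (+ binomial i j * ⟨ + (m ℕ.+ 2) + + (2 ℕ.* j) ⟩ i) ∎)
    where
    reassoc : ∀ m i j → m ℕ.+ 2 ℕ.* (i ℕ.+ j) ≡ m ℕ.+ 2 ℕ.* j ℕ.+ 2 ℕ.* i
    reassoc = ℕ-Solver.solve-∀
    shift : + (m ℕ.+ 2 ℕ.* j) + + 2 ≡ + (m ℕ.+ 2) + + (2 ℕ.* j)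
    shift = cong +_ (swap m j)
      where
      swap : ∀ m j → m ℕ.+ 2 ℕ.* j ℕ.+ 2 ≡ m ℕ.+ 2 ℕ.+ 2 ℕ.* j
      swap = ℕ-Solver.solve-∀
    regroup : ∀ x y c z p → x * y * c * (z * p) ≡ y * z * x * (c * p)
    regroup = solve-∀

  ⟨+suc⟩≢0 : ∀ y k → ⟨ + suc y ⟩ k ≢ + 0
  ⟨+suc⟩≢0 y = ⟨⟩≢0 (λ j ())

  ⟨⟩-odd≢0 : ∀ m₁ {m₂} n → ¬ 2 ∣ m₂ → ∀ k → ⟨ + (m₁ ℕ.+ m₂) - + (m₁ ℕ.+ 2 ℕ.* n) ⟩ k ≢ + 0
  ⟨⟩-odd≢0 m₁ {m₂} n m₂-odd = ⟨⟩≢0 factor≢0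
    where
    factor≢0 : ∀ j → + (m₁ ℕ.+ m₂) - + (m₁ ℕ.+ 2 ℕ.* n) + + (2 ℕ.* j) ≢ + 0
    factor≢0 j eq = odd+even≢even j n m₂-odd (ℕₚ.+-cancelˡ-≡ m₁ _ _ (trans (sym (ℕₚ.+-assoc m₁ m₂ _)) (+-injective sum≡)))
      where
      swap : ∀ a b c → a + c - b ≡ a - b + c
      swap = solve-∀
      sum≡ : + (m₁ ℕ.+ m₂) + + (2 ℕ.* j) ≡ + (m₁ ℕ.+ 2 ℕ.* n)
      sum≡ = i-j≡0⇒i≡j _ _ (trans (swap (+ (m₁ ℕ.+ m₂)) (+ (m₁ ℕ.+ 2 ℕ.* n)) (+ (2 ℕ.* j))) eq)

  +[m₁+2]-[m₁+m₂-d]≡+[2+2n] : ∀ m₁ m₂ n →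
                               + (m₁ ℕ.+ 2) - (+ (m₁ ℕ.+ m₂) - + (m₂ ℕ.+ 2 ℕ.* n)) ≡ + (2 ℕ.+ 2 ℕ.* n)
  +[m₁+2]-[m₁+m₂-d]≡+[2+2n] m₁ m₂ n = cancel (+ m₁) (+ m₂) (+ (2 ℕ.* n))
    where
    cancel : ∀ a b t → a + + 2 - (a + b - (b + t)) ≡ + 2 + t
    cancel = solve-∀

module FieldLemmas {c ℓ} (F : Field c ℓ) where
  import Data.Nat as ℕ
  import Data.Nat.Properties as ℕₚ
  import Data.Integer as ℤ
  import Data.Integer.Properties as ℤₚ
  open import Data.Fin.Properties using (toℕ<n)
  open import Data.List using (upTo; applyUpTo)
  open Field F
  open FieldOps F
  open Poly F
  open import Algebra.Properties.Ring ring using (-‿distribˡ-*; -‿distribʳ-*; -0#≈0#; -‿involutive; -‿+-comm)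
  open import Algebra.Properties.Semiring.Mult semiring using (_×_; ×-homo-+; ×1-homo-*)
  open import Algebra.Properties.Semiring.Sum semiring using (sum; sum-cong-≋; ∑-distrib-+; ∑-comm; *-distribˡ-sum)
  open import Algebra.Solver.Ring.NaturalCoefficients.Default commutativeSemiring using (solve; _:=_; _:+_)
  open import Algebra.Properties.Semiring.Exp semiring using (_^_; ^-congʳ)
  open import Relation.Binary.Reasoning.Setoid setoid

  ℕ→F≡×1# : ∀ n → ℕ→F n ≡ n × 1#
  ℕ→F≡×1# zero    = ≡.refl
  ℕ→F≡×1# (suc n) = ≡.cong (λ x → 1# + x) (ℕ→F≡×1# n)

  ℕ→F-+ : ∀ m n → ℕ→F (m ℕ.+ n) ≈ ℕ→F m + ℕ→F n
  ℕ→F-+ m n rewrite ℕ→F≡×1# (m ℕ.+ n) | ℕ→F≡×1# m | ℕ→F≡×1# n = ×-homo-+ 1# m n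

  ℕ→F-* : ∀ m n → ℕ→F (m ℕ.* n) ≈ ℕ→F m * ℕ→F n
  ℕ→F-* m n rewrite ℕ→F≡×1# (m ℕ.* n) | ℕ→F≡×1# m | ℕ→F≡×1# n = ×1-homo-* m n

  ℤ→F-neg : ∀ i → ℤ→F (ℤ.- i) ≈ - ℤ→F i
  ℤ→F-neg (+ zero)  = sym -0#≈0#
  ℤ→F-neg (+ suc n) = refl
  ℤ→F-neg -[1+ n ]  = sym (-‿involutive _)

  ℤ→F-⊖ : ∀ m n → ℤ→F (m ℤ.⊖ n) ≈ ℕ→F m - ℕ→F n
  ℤ→F-⊖ m       zero    = begin
    ℤ→F (m ℤ.⊖ 0) ≡⟨ ≡.cong ℤ→F (ℤₚ.⊖-≥ {m} z≤n) ⟩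
    ℕ→F m         ≈⟨ sym (+-identityʳ _) ⟩
    ℕ→F m + 0#    ≈⟨ +-congˡ (sym -0#≈0#) ⟩
    ℕ→F m - 0#    ∎
  ℤ→F-⊖ zero    (suc n) = sym (+-identityˡ _)
  ℤ→F-⊖ (suc m) (suc n) = begin
    ℤ→F (suc m ℤ.⊖ suc n)     ≡⟨ ≡.cong ℤ→F (ℤₚ.[1+m]⊖[1+n]≡m⊖n m n) ⟩
    ℤ→F (m ℤ.⊖ n)             ≈⟨ ℤ→F-⊖ m n ⟩
    ℕ→F m - ℕ→F n             ≈⟨ sym (+-identityˡ _) ⟩
    0# + (ℕ→F m - ℕ→F n)      ≈⟨ +-congʳ (sym (-‿inverseʳ 1#)) ⟩
    (1# - 1#) + (ℕ→F m - ℕ→F n)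
      ≈⟨ solve 4 (λ o o′ a b → ((o :+ o′) :+ (a :+ b)) := ((o :+ a) :+ (o′ :+ b))) refl 1# (- 1#) (ℕ→F m) (- ℕ→F n) ⟩
    (1# + ℕ→F m) + (- 1# - ℕ→F n) ≈⟨ +-congˡ (-‿+-comm 1# (ℕ→F n)) ⟩
    (1# + ℕ→F m) - (1# + ℕ→F n) ∎

  ℤ→F-+ : ∀ i j → ℤ→F (i ℤ.+ j) ≈ ℤ→F i + ℤ→F j
  ℤ→F-+ (+ m)    (+ n)    = ℕ→F-+ m n
  ℤ→F-+ (+ m)    -[1+ n ] = ℤ→F-⊖ m (suc n)
  ℤ→F-+ -[1+ m ] (+ n)    = trans (ℤ→F-⊖ n (suc m)) (+-comm _ _)
  ℤ→F-+ -[1+ m ] -[1+ n ] = begin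
    - (1# + ℕ→F (suc (m ℕ.+ n)))         ≈⟨ -‿cong (+-congˡ (ℕ→F-+ (suc m) n)) ⟩
    - (1# + (ℕ→F (suc m) + ℕ→F n))
      ≈⟨ -‿cong (solve 3 (λ o a b → (o :+ (a :+ b)) := (a :+ (o :+ b))) refl 1# (ℕ→F (suc m)) (ℕ→F n)) ⟩
    - (ℕ→F (suc m) + ℕ→F (suc n))        ≈⟨ sym (-‿+-comm _ _) ⟩
    - ℕ→F (suc m) + - ℕ→F (suc n)        ∎

  ℤ→F-*+ : ∀ m j → ℤ→F (+ m ℤ.* j) ≈ ℕ→F m * ℤ→F j
  ℤ→F-*+ m (+ n)    = trans (reflexive (≡.cong ℤ→F (≡.sym (ℤₚ.pos-* m n)))) (ℕ→F-* m n)
  ℤ→F-*+ m -[1+ n ] = begin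
    ℤ→F (+ m ℤ.* -[1+ n ])          ≡⟨ ≡.cong ℤ→F (≡.sym (ℤₚ.neg-distribʳ-* (+ m) (+ suc n))) ⟩
    ℤ→F (ℤ.- (+ m ℤ.* + suc n))     ≈⟨ ℤ→F-neg (+ m ℤ.* + suc n) ⟩
    - ℤ→F (+ m ℤ.* + suc n)         ≈⟨ -‿cong (ℤ→F-*+ m (+ suc n)) ⟩
    - (ℕ→F m * ℕ→F (suc n))         ≈⟨ -‿distribʳ-* _ _ ⟩
    ℕ→F m * - ℕ→F (suc n)           ∎

  ℤ→F-* : ∀ i j → ℤ→F (i ℤ.* j) ≈ ℤ→F i * ℤ→F j
  ℤ→F-* (+ m)    j = ℤ→F-*+ m j
  ℤ→F-* -[1+ m ] j = begin
    ℤ→F (-[1+ m ] ℤ.* j)            ≡⟨ ≡.cong ℤ→F (≡.sym (ℤₚ.neg-distribˡ-* (+ suc m) j)) ⟩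
    ℤ→F (ℤ.- (+ suc m ℤ.* j))       ≈⟨ ℤ→F-neg (+ suc m ℤ.* j) ⟩
    - ℤ→F (+ suc m ℤ.* j)           ≈⟨ -‿cong (ℤ→F-*+ (suc m) j) ⟩
    - (ℕ→F (suc m) * ℤ→F j)         ≈⟨ -‿distribˡ-* _ _ ⟩
    - ℕ→F (suc m) * ℤ→F j           ∎

  -x≈0⇒x≈0 : ∀ {x} → - x ≈ 0# → x ≈ 0#
  -x≈0⇒x≈0 -x≈0 = trans (sym (-‿involutive _)) (trans (-‿cong -x≈0) -0#≈0#)

  ℤ→F≈0⇒≡0 : CharZero F → ∀ z → ℤ→F z ≈ 0# → z ≡ + 0
  ℤ→F≈0⇒≡0 char0 (+ n)    eq = ≡.cong +_ (char0 n eq)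
  ℤ→F≈0⇒≡0 char0 -[1+ n ] eq with char0 (suc n) (-x≈0⇒x≈0 eq)
  ... | ()

  -- ∑< is opaque so that unification can recover summands from sums.
  opaque
    ∑< : ℕ → (ℕ → Carrier) → Carrier
    ∑< n h = sum (λ (i : Fin n) → h (toℕ i))

    ∑<-cong : ∀ n {h h′} → (∀ i → i < n → h i ≈ h′ i) → ∑< n h ≈ ∑< n h′
    ∑<-cong n h≈h′ = sum-cong-≋ (λ i → h≈h′ (toℕ i) (toℕ<n i))

    ∑<-zero : ∀ n {h} → (∀ i → i < n → h i ≈ 0#) → ∑< n h ≈ 0#
    ∑<-zero zero    h≈0 = refl
    ∑<-zero (suc n) h≈0 = trans (+-cong (h≈0 0 (s≤s z≤n)) (∑<-zero n (λ i i<n → h≈0 (suc i) (s≤s i<n)))) (+-identityˡ 0#)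

    ∑<-δ : ∀ n {h} k → k < n → (∀ i → i < n → i ≢ k → h i ≈ 0#) → ∑< n h ≈ h k
    ∑<-δ (suc n) zero    _         others≈0 =
      trans (+-congˡ (∑<-zero n (λ i i<n → others≈0 (suc i) (s≤s i<n) (λ ())))) (+-identityʳ _)
    ∑<-δ (suc n) (suc k) (s≤s k<n) others≈0 =
      trans (+-congʳ (others≈0 0 (s≤s z≤n) (λ ())))
            (trans (+-identityˡ _)
                   (∑<-δ n k k<n (λ i i<n i≢k → others≈0 (suc i) (s≤s i<n) (λ eq → i≢k (ℕₚ.suc-injective eq)))))

    ∑<-last : ∀ n h → ∑< (suc n) h ≈ ∑< n h + h n
    ∑<-last zero    h = trans (+-identityʳ _) (sym (+-identityˡ _))
    ∑<-last (suc n) h = trans (+-congˡ (∑<-last n (λ i → h (suc i)))) (sym (+-assoc _ _ _))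

    ∑<-telescope : ∀ n (z : ℕ → Carrier) → ∑< n (λ i → z i - z (suc i)) ≈ z 0 - z n
    ∑<-telescope zero    z = sym (-‿inverseʳ _)
    ∑<-telescope (suc n) z = begin
      (z 0 - z 1) + ∑< n (λ i → z (suc i) - z (suc (suc i)))
        ≈⟨ +-congˡ (∑<-telescope n (λ i → z (suc i))) ⟩
      (z 0 - z 1) + (z 1 - z (suc n))
        ≈⟨ solve 4 (λ a b′ b c′ → ((a :+ b′) :+ (b :+ c′)) := ((a :+ c′) :+ (b :+ b′))) refl (z 0) (- z 1) (z 1) (- z (suc n)) ⟩
      (z 0 - z (suc n)) + (z 1 - z 1)
        ≈⟨ trans (+-congˡ (-‿inverseʳ _)) (+-identityʳ _) ⟩
      z 0 - z (suc n) ∎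

    ∑<-*ˡ : ∀ n k h → k * ∑< n h ≈ ∑< n (λ i → k * h i)
    ∑<-*ˡ n k h = *-distribˡ-sum {n} k (λ i → h (toℕ i))

    ∑<-comm : ∀ m n (h : ℕ → ℕ → Carrier) → ∑< m (λ i → ∑< n (h i)) ≈ ∑< n (λ j → ∑< m (λ i → h i j))
    ∑<-comm m n h = ∑-comm {m} {n} (λ i j → h (toℕ i) (toℕ j))

    ∑<-suc : ∀ n h → ∑< (suc n) h ≈ h 0 + ∑< n (λ i → h (suc i))
    ∑<-suc n h = refl

    ∑<-one : ∀ h → ∑< 1 h ≈ h 0
    ∑<-one h = +-identityʳ _

    ∑<-linear : ∀ n f s g → ∑< n (λ i → f i + s * g i) ≈ ∑< n f + s * ∑< n g
    ∑<-linear n f s g = trans (∑-distrib-+ {n} (λ i → f (toℕ i)) (λ i → s * g (toℕ i)))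
                              (+-congˡ (sym (∑<-*ˡ n s g)))

    ∑-upTo : ∀ n h → ∑ (upTo n) h ≡ ∑< n h
    ∑-upTo n h = ∑-applyUpTo n (λ i → i)
      where
      ∑-applyUpTo : ∀ n g → ∑ (applyUpTo g n) h ≡ ∑< n (λ i → h (g i))
      ∑-applyUpTo zero    g = ≡.refl
      ∑-applyUpTo (suc n) g = ≡.cong (λ x → h (g 0) + x) (∑-applyUpTo n (λ i → g (suc i)))

  ℤ→F-antidiagonal : ∀ n h → ℤ→F (antidiagonal n h) ≈ ∑< (suc n) (λ i → ℤ→F (h i (n ∸ i)))
  ℤ→F-antidiagonal zero    h = sym (∑<-one _)
  ℤ→F-antidiagonal (suc n) h = begin
    ℤ→F (h 0 (suc n) ℤ.+ antidiagonal n (λ i j → h (suc i) j))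
      ≈⟨ ℤ→F-+ (h 0 (suc n)) _ ⟩
    ℤ→F (h 0 (suc n)) + ℤ→F (antidiagonal n (λ i j → h (suc i) j))
      ≈⟨ +-congˡ (ℤ→F-antidiagonal n (λ i j → h (suc i) j)) ⟩
    ℤ→F (h 0 (suc n)) + ∑< (suc n) (λ i → ℤ→F (h (suc i) (n ∸ i)))
      ≈⟨ sym (∑<-suc (suc n) (λ i → ℤ→F (h i (suc n ∸ i)))) ⟩
    ∑< (suc (suc n)) (λ i → ℤ→F (h i (suc n ∸ i))) ∎

  t²≈1⇒t^[2i]≈1 : ∀ {t} → t * t ≈ 1# → ∀ i → t ^ (2 ℕ.* i) ≈ 1#
  t²≈1⇒t^[2i]≈1 t²≈1 zero    = refl
  t²≈1⇒t^[2i]≈1 {t} t²≈1 (suc i) = begin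
    t ^ (2 ℕ.* suc i)          ≈⟨ ^-congʳ t (2*suc i) ⟩
    t * (t * t ^ (2 ℕ.* i))    ≈⟨ sym (*-assoc t t _) ⟩
    t * t * t ^ (2 ℕ.* i)      ≈⟨ *-cong t²≈1 (t²≈1⇒t^[2i]≈1 t²≈1 i) ⟩
    1# * 1#                    ≈⟨ *-identityˡ 1# ⟩
    1# ∎

module PolynomialLemmas {c ℓ} (F : Field c ℓ) where
  import Data.Nat as ℕ
  import Data.Nat.Properties as ℕₚ
  open Field F
  open Poly F
  open FieldLemmas F
  open import Algebra.Properties.Ring ring using (-‿distribˡ-*)
  open import Algebra.Properties.Semiring.Exp semiring using (_^_)
  open import Algebra.Solver.Ring.NaturalCoefficients.Default commutativeSemiring using (solve; _:=_; _:*_)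
  open import Relation.Binary.Reasoning.Setoid setoid

  coeff-mono-≡ : ∀ k i j → coeff (mono k i j) i j ≈ k
  coeff-mono-≡ k i j with i ℕ.≟ i | j ℕ.≟ j
  ... | yes _   | yes _   = refl
  ... | no i≢i  | _       = contradiction ≡.refl i≢i
  ... | yes _   | no j≢j  = contradiction ≡.refl j≢j

  coeff-mono-≢ : ∀ k i j a b → (a ≡ i → b ≡ j → ⊥) → coeff (mono k i j) a b ≈ 0#
  coeff-mono-≢ k i j a b ≢ij with a ℕ.≟ i | b ℕ.≟ j
  ... | yes a≡i | yes b≡j = contradiction b≡j (≢ij a≡i)
  ... | yes _   | no _    = refl
  ... | no _    | _       = refl

  mono*≈0 : ∀ k i j a b x → (a ≡ i → b ≡ j → ⊥) → coeff (mono k i j) a b * x ≈ 0#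
  mono*≈0 k i j a b x ≢ij = trans (*-congʳ (coeff-mono-≢ k i j a b ≢ij)) (zeroˡ x)

  mulCoeff≈∑< : ∀ p q a b → mulCoeff p q a b ≈ ∑< (suc a) (λ i → ∑< (suc b) (λ j → coeff p i j * coeff q (a ∸ i) (b ∸ j)))
  mulCoeff≈∑< p q a b = trans (reflexive (∑-upTo (suc a) _))
                              (∑<-cong (suc a) (λ i _ → reflexive (∑-upTo (suc b) _)))

  mulCoeff-linear : ∀ {α β γ} s q a b → (∀ i j → coeff α i j ≈ coeff β i j + s * coeff γ i j) →
                    mulCoeff α q a b ≈ mulCoeff β q a b + s * mulCoeff γ q a b
  mulCoeff-linear {α} {β} {γ} s q a b α≈β+sγ = begin
    mulCoeff α q a b
      ≈⟨ mulCoeff≈∑< α q a b ⟩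
    ∑< (suc a) (λ i → ∑< (suc b) (λ j → coeff α i j * Q i j))
      ≈⟨ ∑<-cong (suc a) (λ i _ → ∑<-cong (suc b) (λ j _ → distribute i j)) ⟩
    ∑< (suc a) (λ i → ∑< (suc b) (λ j → coeff β i j * Q i j + s * (coeff γ i j * Q i j)))
      ≈⟨ ∑<-cong (suc a) (λ i _ → ∑<-linear (suc b) _ s _) ⟩
    ∑< (suc a) (λ i → ∑< (suc b) (λ j → coeff β i j * Q i j) + s * ∑< (suc b) (λ j → coeff γ i j * Q i j))
      ≈⟨ ∑<-linear (suc a) _ s _ ⟩
    ∑< (suc a) (λ i → ∑< (suc b) (λ j → coeff β i j * Q i j)) + s * ∑< (suc a) (λ i → ∑< (suc b) (λ j → coeff γ i j * Q i j))
      ≈⟨ sym (+-cong (mulCoeff≈∑< β q a b) (*-congˡ (mulCoeff≈∑< γ q a b))) ⟩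
    mulCoeff β q a b + s * mulCoeff γ q a b ∎
    where
    Q : ℕ → ℕ → Carrier
    Q i j = coeff q (a ∸ i) (b ∸ j)
    distribute : ∀ i j → coeff α i j * Q i j ≈ coeff β i j * Q i j + s * (coeff γ i j * Q i j)
    distribute i j = trans (*-congʳ (α≈β+sγ i j)) (trans (distribʳ _ _ _) (+-congˡ (*-assoc _ _ _)))

  mulCoeff-mono : ∀ k i₀ j₀ q a b → mulCoeff (mono k i₀ j₀) q (i₀ ℕ.+ a) (j₀ ℕ.+ b) ≈ k * coeff q a b
  mulCoeff-mono k i₀ j₀ q a b = begin
    mulCoeff (mono k i₀ j₀) q (i₀ ℕ.+ a) (j₀ ℕ.+ b)
      ≈⟨ mulCoeff≈∑< (mono k i₀ j₀) q (i₀ ℕ.+ a) (j₀ ℕ.+ b) ⟩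
    ∑< (suc (i₀ ℕ.+ a)) (λ i → ∑< (suc (j₀ ℕ.+ b)) (term i))
      ≈⟨ ∑<-δ (suc (i₀ ℕ.+ a)) i₀ (s≤s (ℕₚ.m≤m+n i₀ a))
              (λ i _ i≢i₀ → ∑<-zero (suc (j₀ ℕ.+ b)) (λ j _ → mono*≈0 k i₀ j₀ i j _ (λ i≡i₀ _ → i≢i₀ i≡i₀))) ⟩
    ∑< (suc (j₀ ℕ.+ b)) (term i₀)
      ≈⟨ ∑<-δ (suc (j₀ ℕ.+ b)) j₀ (s≤s (ℕₚ.m≤m+n j₀ b)) (λ j _ j≢j₀ → mono*≈0 k i₀ j₀ i₀ j _ (λ _ → j≢j₀)) ⟩
    term i₀ j₀
      ≈⟨ *-cong (coeff-mono-≡ k i₀ j₀) (reflexive (≡.cong₂ (coeff q) (ℕₚ.m+n∸m≡n i₀ a) (ℕₚ.m+n∸m≡n j₀ b))) ⟩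
    k * coeff q a b ∎
    where
    term : ℕ → ℕ → Carrier
    term i j = coeff (mono k i₀ j₀) i j * coeff q (i₀ ℕ.+ a ∸ i) (j₀ ℕ.+ b ∸ j)

  mulCoeff-mono-<ˣ : ∀ k i₀ j₀ q {a} b → a < i₀ → mulCoeff (mono k i₀ j₀) q a b ≈ 0#
  mulCoeff-mono-<ˣ k i₀ j₀ q {a} b a<i₀ = trans (mulCoeff≈∑< (mono k i₀ j₀) q a b)
    (∑<-zero (suc a) {λ i → ∑< (suc b) (term i)} (λ i i≤a → ∑<-zero (suc b) {term i} (λ j _ →
      mono*≈0 k i₀ j₀ i j _ (λ i≡i₀ _ → ℕₚ.<-irrefl i≡i₀ (ℕₚ.<-≤-trans i≤a a<i₀)))))
    where
    term : ℕ → ℕ → Carrier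
    term i j = coeff (mono k i₀ j₀) i j * coeff q (a ∸ i) (b ∸ j)

  mulCoeff-mono-<ʸ : ∀ k i₀ j₀ q a {b} → b < j₀ → mulCoeff (mono k i₀ j₀) q a b ≈ 0#
  mulCoeff-mono-<ʸ k i₀ j₀ q a {b} b<j₀ = trans (mulCoeff≈∑< (mono k i₀ j₀) q a b)
    (∑<-zero (suc a) {λ i → ∑< (suc b) (term i)} (λ i _ → ∑<-zero (suc b) {term i} (λ j j≤b →
      mono*≈0 k i₀ j₀ i j _ (λ _ j≡j₀ → ℕₚ.<-irrefl j≡j₀ (ℕₚ.<-≤-trans j≤b b<j₀)))))
    where
    term : ℕ → ℕ → Carrier
    term i j = coeff (mono k i₀ j₀) i j * coeff q (a ∸ i) (b ∸ j)

  x*-coeff y*-coeff : S → ℕ → ℕ → Carrier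
  x*-coeff q zero    b       = 0#
  x*-coeff q (suc a) b       = coeff q a b
  y*-coeff q a       zero    = 0#
  y*-coeff q a       (suc b) = coeff q a b

  mulCoeff-x : ∀ q a b → mulCoeff xS q a b ≈ x*-coeff q a b
  mulCoeff-x q zero    b = mulCoeff-mono-<ˣ 1# 1 0 q b (s≤s z≤n)
  mulCoeff-x q (suc a) b = trans (mulCoeff-mono 1# 1 0 q a b) (*-identityˡ _)

  mulCoeff-y : ∀ q a b → mulCoeff yS q a b ≈ y*-coeff q a b
  mulCoeff-y q a zero    = mulCoeff-mono-<ʸ 1# 0 1 q a (s≤s z≤n)
  mulCoeff-y q a (suc b) = trans (mulCoeff-mono 1# 0 1 q a b) (*-identityˡ _)

  -- the value at (x , y) = (1 , t) of the degree-d part of the polynomial with coefficients p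
  degreeValue : ℕ → Carrier → (ℕ → ℕ → Carrier) → Carrier
  degreeValue d t p = ∑< (suc d) (λ a → t ^ (d ∸ a) * p a (d ∸ a))

  degreeValue-cong : ∀ d t {p p′} → (∀ a b → p a b ≈ p′ a b) → degreeValue d t p ≈ degreeValue d t p′
  degreeValue-cong d t p≈p′ = ∑<-cong (suc d) (λ a _ → *-congˡ (p≈p′ a (d ∸ a)))

  degreeValue-∑< : ∀ d t n (p : ℕ → ℕ → ℕ → Carrier) →
                   degreeValue d t (λ a b → ∑< n (λ k → p k a b)) ≈ ∑< n (λ k → degreeValue d t (p k))
  degreeValue-∑< d t n p = trans (∑<-cong (suc d) (λ a _ → ∑<-*ˡ n _ _)) (∑<-comm (suc d) n _)

  degreeValue-mono : ∀ {d} t k i j → i ℕ.+ j ≡ d → degreeValue d t (coeff (mono k i j)) ≈ t ^ j * k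
  degreeValue-mono t k i j ≡.refl = trans
    (∑<-δ (suc (i ℕ.+ j)) i (s≤s (ℕₚ.m≤m+n i j))
          (λ a _ a≢i → trans (*-congˡ (coeff-mono-≢ k i j a _ (λ a≡i _ → a≢i a≡i))) (zeroʳ _)))
    at-i
    where
    at-i : t ^ (i ℕ.+ j ∸ i) * coeff (mono k i j) i (i ℕ.+ j ∸ i) ≈ t ^ j * k
    at-i rewrite ℕₚ.m+n∸m≡n i j = *-congˡ (coeff-mono-≡ k i j)

  degreeValue-x+sy≈0 : ∀ d {t s} q → t * s ≈ - 1# → degreeValue d t (λ a b → x*-coeff q a b + s * y*-coeff q a b) ≈ 0#
  degreeValue-x+sy≈0 d {t} {s} q ts≈-1 = begin
    ∑< (suc d) term                       ≈⟨ ∑<-last d term ⟩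
    ∑< d term + term d                    ≈⟨ +-cong (∑<-cong d telescoping) last-term ⟩
    ∑< d (λ a → z a - z (suc a)) + z d    ≈⟨ +-congʳ (∑<-telescope d z) ⟩
    (z 0 - z d) + z d                     ≈⟨ trans (+-assoc _ _ _) (trans (+-congˡ (-‿inverseˡ _)) (+-identityʳ _)) ⟩
    t ^ d * 0#                            ≈⟨ zeroʳ _ ⟩
    0# ∎
    where
    term z : ℕ → Carrier
    term a = t ^ (d ∸ a) * (x*-coeff q a (d ∸ a) + s * y*-coeff q a (d ∸ a))
    z a = t ^ (d ∸ a) * x*-coeff q a (d ∸ a)
    last-term : term d ≈ z d
    last-term rewrite ℕₚ.n∸n≡0 d = *-congˡ (trans (+-congˡ (zeroʳ s)) (+-identityʳ _))
    step : ∀ a c → t ^ suc c * (x*-coeff q a (suc c) + s * coeff q a c) ≈ t ^ suc c * x*-coeff q a (suc c) - t ^ c * coeff q a c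
    step a c = begin
      t ^ suc c * (x*-coeff q a (suc c) + s * coeff q a c)
        ≈⟨ distribˡ _ _ _ ⟩
      t ^ suc c * x*-coeff q a (suc c) + t * t ^ c * (s * coeff q a c)
        ≈⟨ +-congˡ (solve 4 (λ t p s w → ((t :* p) :* (s :* w)) := ((t :* s) :* (p :* w))) refl t (t ^ c) s (coeff q a c)) ⟩
      t ^ suc c * x*-coeff q a (suc c) + t * s * (t ^ c * coeff q a c)
        ≈⟨ +-congˡ (trans (*-congʳ ts≈-1) (trans (sym (-‿distribˡ-* _ _)) (-‿cong (*-identityˡ _)))) ⟩
      t ^ suc c * x*-coeff q a (suc c) - t ^ c * coeff q a c ∎
    telescoping : ∀ a → a < d → term a ≈ z a - z (suc a)
    telescoping a a<d with d ∸ a | ℕₚ.+-∸-assoc 1 a<d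
    ... | .(suc (d ∸ suc a)) | ≡.refl = step a (d ∸ suc a)

module ThetaLemmas {c ℓ} (F : Field c ℓ) (char0 : CharZero F) where
  import Data.Nat as ℕ
  import Data.Nat.Properties as ℕₚ
  import Data.Integer as ℤ
  import Data.Nat.Tactic.RingSolver as ℕ-Solver
  import Data.Integer.Tactic.RingSolver as ℤ-Solver
  open Field F
  open FieldOps F
  open Poly F
  open FieldLemmas F
  open PolynomialLemmas F
  open Theta F char0
  open import Data.List using ([]; _∷_; foldr; upTo)
  open import Algebra.Properties.Ring ring using (-‿involutive; -1*x≈-x)
  open import Algebra.Solver.Ring.NaturalCoefficients.Default commutativeSemiring using (solve; _:=_; _:*_)
  open import Relation.Binary.Reasoning.Setoid setoid

  frac-cancel : ∀ num x y z → ℕ→F (x !! ℕ.* y !! ℕ.* z !!) * frac num x y z ≈ ℤ→F num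
  frac-cancel num x y z = cancel (ℤ→F num) (inverse (ℕ→F (x !! ℕ.* y !! ℕ.* z !!)) _)
    where
    cancel : ∀ {w} a (w⁻¹ : Σ Carrier (λ v → w * v ≈ 1#)) → w * (a * proj₁ w⁻¹) ≈ a
    cancel {w} a (v , wv≈1) = trans (solve 3 (λ w a v → (w :* (a :* v)) := (a :* (w :* v))) refl w a v)
                                    (trans (*-congˡ wv≈1) (*-identityʳ a))

  frac-scaled : ∀ num x y z k K → + (x !! ℕ.* y !! ℕ.* z !!) ℤ.* k ≡ + K →
                ℕ→F K * frac num x y z ≈ ℤ→F (k ℤ.* num)
  frac-scaled num x y z k K den*k≡K = begin
    ℕ→F K * frac num x y z                    ≡⟨ ≡.cong (λ i → ℤ→F i * frac num x y z) (≡.sym den*k≡K) ⟩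
    ℤ→F (+ den ℤ.* k) * frac num x y z         ≈⟨ *-congʳ (ℤ→F-* (+ den) k) ⟩
    ℕ→F den * ℤ→F k * frac num x y z
      ≈⟨ solve 3 (λ a b c → ((a :* b) :* c) := (b :* (a :* c))) refl (ℕ→F den) (ℤ→F k) (frac num x y z) ⟩
    ℤ→F k * (ℕ→F den * frac num x y z)         ≈⟨ *-congˡ (frac-cancel num x y z) ⟩
    ℤ→F k * ℤ→F num                            ≈⟨ sym (ℤ→F-* k num) ⟩
    ℤ→F (k ℤ.* num) ∎
    where
    den : ℕ
    den = x !! ℕ.* y !! ℕ.* z !!

  frac≉0 : ∀ {num} x y z → num ≢ + 0 → ¬ frac num x y z ≈ 0#
  frac≉0 {num} x y z num≢0 frac≈0 =
    num≢0 (ℤ→F≈0⇒≡0 char0 num (trans (sym (frac-cancel num x y z)) (trans (*-congˡ frac≈0) (zeroʳ _))))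

  coeff-∑S : ∀ U t a b → coeff (∑S U t) a b ≈ ∑< (suc U) (λ i → coeff (t i) a b)
  coeff-∑S U t a b = trans (reflexive (coeff-foldr (upTo (suc U)))) (reflexive (∑-upTo (suc U) _))
    where
    coeff-foldr : ∀ l → coeff (foldr (λ i acc → t i +S acc) 0S l) a b ≡ ∑ l (λ i → coeff (t i) a b)
    coeff-foldr []      = ≡.refl
    coeff-foldr (i ∷ l) = ≡.cong (λ s → coeff (t i) a b + s) (coeff-foldr l)

  -- f m = ∑ᵢ coeffᶠ (d m) (m₁ m) (U₁ m) (a₀ m) i · x^(d m - 2i) y^(2i)
  coeffᶠ : ℕ → ℕ → ℕ → ℤ → ℕ → Carrier
  coeffᶠ d m₁ n A i = frac (sgn i ℤ.* ⟨ A ⟩ (n ∸ i)) (d ∸ m₁ ∸ 2 ℕ.* i) (d ∸ 2 ℕ.* i) (2 ℕ.* i)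

  coeffᶠ-scaled : ∀ m₁ i j A →
    ℕ→F ((2 ℕ.* (i ℕ.+ j)) !! ℕ.* (m₁ ℕ.+ 2 ℕ.* (i ℕ.+ j)) !!) * coeffᶠ (m₁ ℕ.+ 2 ℕ.* (i ℕ.+ j)) m₁ (i ℕ.+ j) A i ≈
    ℤ→F (+ binomial i j ℤ.* (sgn i ℤ.* ⟨ A ⟩ j ℤ.* ⟨ + (m₁ ℕ.+ 2) ℤ.+ + (2 ℕ.* j) ⟩ i))
  coeffᶠ-scaled m₁ i j A = begin
    ℕ→F ((2 ℕ.* (i ℕ.+ j)) !! ℕ.* (m₁ ℕ.+ 2 ℕ.* (i ℕ.+ j)) !!) * frac (sgn i ℤ.* ⟨ A ⟩ (i ℕ.+ j ∸ i)) x y (2 ℕ.* i)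
      ≈⟨ frac-scaled _ x y (2 ℕ.* i) k _ (≡.trans (≡.cong₂ (λ u v → + (u !! ℕ.* v !! ℕ.* (2 ℕ.* i) !!) ℤ.* k) x≡2j y≡m₁+2j)
                                                   (!!-split m₁ i j)) ⟩
    ℤ→F (k ℤ.* (sgn i ℤ.* ⟨ A ⟩ (i ℕ.+ j ∸ i)))
      ≡⟨ ≡.cong (λ l → ℤ→F (k ℤ.* (sgn i ℤ.* ⟨ A ⟩ l))) (ℕₚ.m+n∸m≡n i j) ⟩
    ℤ→F (k ℤ.* (sgn i ℤ.* ⟨ A ⟩ j))
      ≡⟨ ≡.cong ℤ→F (regroup (+ binomial i j) (⟨ + (m₁ ℕ.+ 2) ℤ.+ + (2 ℕ.* j) ⟩ i) (sgn i) (⟨ A ⟩ j)) ⟩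
    ℤ→F (+ binomial i j ℤ.* (sgn i ℤ.* ⟨ A ⟩ j ℤ.* ⟨ + (m₁ ℕ.+ 2) ℤ.+ + (2 ℕ.* j) ⟩ i)) ∎
    where
    x y : ℕ
    x = m₁ ℕ.+ 2 ℕ.* (i ℕ.+ j) ∸ m₁ ∸ 2 ℕ.* i
    y = m₁ ℕ.+ 2 ℕ.* (i ℕ.+ j) ∸ 2 ℕ.* i
    k : ℤ
    k = + binomial i j ℤ.* ⟨ + (m₁ ℕ.+ 2) ℤ.+ + (2 ℕ.* j) ⟩ i
    x≡2j : x ≡ 2 ℕ.* j
    x≡2j = ≡.trans (≡.cong (_∸ 2 ℕ.* i) (≡.trans (ℕₚ.m+n∸m≡n m₁ _) (ℕₚ.*-distribˡ-+ 2 i j))) (ℕₚ.m+n∸m≡n (2 ℕ.* i) _)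
    y≡m₁+2j : y ≡ m₁ ℕ.+ 2 ℕ.* j
    y≡m₁+2j = ≡.trans (≡.cong (_∸ 2 ℕ.* i) (split m₁ i j)) (ℕₚ.m+n∸m≡n (2 ℕ.* i) _)
      where
      split : ∀ m₁ i j → m₁ ℕ.+ 2 ℕ.* (i ℕ.+ j) ≡ 2 ℕ.* i ℕ.+ (m₁ ℕ.+ 2 ℕ.* j)
      split = ℕ-Solver.solve-∀
    regroup : ∀ b p s a → b ℤ.* p ℤ.* (s ℤ.* a) ≡ b ℤ.* (s ℤ.* a ℤ.* p)
    regroup = ℤ-Solver.solve-∀

  ∑coeffᶠ-closed-form : ∀ {d} m₁ n A → d ≡ m₁ ℕ.+ 2 ℕ.* n →
    ℕ→F ((2 ℕ.* n) !! ℕ.* d !!) * ∑< (suc n) (coeffᶠ d m₁ n A) ≈ ℤ→F (sgn n ℤ.* ⟨ + (m₁ ℕ.+ 2) ℤ.- A ⟩ n)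
  ∑coeffᶠ-closed-form m₁ n A ≡.refl = begin
    K n * ∑< (suc n) (coeffᶠ (m₁ ℕ.+ 2 ℕ.* n) m₁ n A)
      ≈⟨ ∑<-*ˡ (suc n) (K n) _ ⟩
    ∑< (suc n) (λ i → K n * coeffᶠ (m₁ ℕ.+ 2 ℕ.* n) m₁ n A i)
      ≈⟨ ∑<-cong (suc n) (λ i i<1+n → scaled i (ℕₚ.m+[n∸m]≡n (ℕₚ.m<1+n⇒m≤n i<1+n))) ⟩
    ∑< (suc n) (λ i → ℤ→F (term i (n ∸ i)))
      ≈⟨ sym (ℤ→F-antidiagonal n term) ⟩
    ℤ→F (vandermondeSum n A (+ (m₁ ℕ.+ 2)))
      ≡⟨ ≡.cong ℤ→F (vandermonde n A (+ (m₁ ℕ.+ 2))) ⟩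
    ℤ→F (sgn n ℤ.* ⟨ + (m₁ ℕ.+ 2) ℤ.- A ⟩ n) ∎
    where
    K : ℕ → Carrier
    K n = ℕ→F ((2 ℕ.* n) !! ℕ.* (m₁ ℕ.+ 2 ℕ.* n) !!)
    term : ℕ → ℕ → ℤ
    term i j = + binomial i j ℤ.* (sgn i ℤ.* ⟨ A ⟩ j ℤ.* ⟨ + (m₁ ℕ.+ 2) ℤ.+ + (2 ℕ.* j) ⟩ i)
    scaled : ∀ i {j} → i ℕ.+ j ≡ n → K n * coeffᶠ (m₁ ℕ.+ 2 ℕ.* n) m₁ n A i ≈ ℤ→F (term i j)
    scaled i {j} i+j≡n =
      ≡.subst (λ n → K n * coeffᶠ (m₁ ℕ.+ 2 ℕ.* n) m₁ n A i ≈ ℤ→F (term i j)) i+j≡n (coeffᶠ-scaled m₁ i j A)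

  degreeValue-even : ∀ {t} D U k → t * t ≈ 1# → 2 ℕ.* U ≤ D →
    degreeValue D t (coeff (∑S U (λ i → mono (k i) (D ∸ 2 ℕ.* i) (2 ℕ.* i)))) ≈ ∑< (suc U) k
  degreeValue-even {t} D U k t²≈1 2U≤D = begin
    degreeValue D t (coeff (∑S U monomial))
      ≈⟨ degreeValue-cong D t (coeff-∑S U monomial) ⟩
    degreeValue D t (λ a b → ∑< (suc U) (λ i → coeff (monomial i) a b))
      ≈⟨ degreeValue-∑< D t (suc U) (λ i → coeff (monomial i)) ⟩
    ∑< (suc U) (λ i → degreeValue D t (coeff (monomial i)))
      ≈⟨ ∑<-cong (suc U) (λ i i<1+U → trans (degreeValue-mono t (k i) (D ∸ 2 ℕ.* i) (2 ℕ.* i) (ℕₚ.m∸n+n≡m (2i≤D i<1+U)))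
                                             (trans (*-congʳ (t²≈1⇒t^[2i]≈1 t²≈1 i)) (*-identityˡ _))) ⟩
    ∑< (suc U) k ∎
    where
    monomial : ℕ → S
    monomial i = mono (k i) (D ∸ 2 ℕ.* i) (2 ℕ.* i)
    2i≤D : ∀ {i} → i < suc U → 2 ℕ.* i ≤ D
    2i≤D i<1+U = ℕₚ.≤-trans (ℕₚ.*-monoʳ-≤ 2 (ℕₚ.m<1+n⇒m≤n i<1+U)) 2U≤D

  module _ (m : Multiplicity) (d≡m₁+2U₁ : d m ≡ m₁ m ℕ.+ 2 ℕ.* U₁ m) where

    module _ (m₂-odd : ¬ 2 ∣ m₂ m) where

      ⟨a₀⟩≢0 : ∀ k → ⟨ a₀ m ⟩ k ≢ + 0
      ⟨a₀⟩≢0 k =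
        ≡.subst (λ e → ⟨ + (m₁ m ℕ.+ m₂ m) ℤ.- + e ⟩ k ≢ + 0) (≡.sym d≡m₁+2U₁) (⟨⟩-odd≢0 (m₁ m) (U₁ m) m₂-odd k)

      coeff-f-xᵈ≉0 : ¬ coeff (f m) (d m) 0 ≈ 0#
      coeff-f-xᵈ≉0 coeff≈0 = frac≉0 (d m ∸ m₁ m) (d m) 0 (sgn*≢0 0 (⟨a₀⟩≢0 (U₁ m))) (begin
        coeffᶠ (d m) (m₁ m) (U₁ m) (a₀ m) 0
          ≈⟨ sym (coeff-mono-≡ _ (d m) 0) ⟩
        coeff (monomial 0) (d m) 0
          ≈⟨ sym (∑<-δ (suc (U₁ m)) 0 (s≤s z≤n) others) ⟩
        ∑< (suc (U₁ m)) (λ i → coeff (monomial i) (d m) 0)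
          ≈⟨ sym (coeff-∑S (U₁ m) monomial (d m) 0) ⟩
        coeff (f m) (d m) 0
          ≈⟨ coeff≈0 ⟩
        0# ∎)
        where
        monomial : ℕ → S
        monomial i = mono (coeffᶠ (d m) (m₁ m) (U₁ m) (a₀ m) i) (d m ∸ 2 ℕ.* i) (2 ℕ.* i)
        others : ∀ i → i < suc (U₁ m) → i ≢ 0 → coeff (monomial i) (d m) 0 ≈ 0#
        others zero    _ 0≢0 = contradiction ≡.refl 0≢0
        others (suc i) _ _   = coeff-mono-≢ _ (d m ∸ 2 ℕ.* suc i) (2 ℕ.* suc i) (d m) 0 (λ _ ())

      coeff-g-yᵈ≉0 : ¬ coeff (g m) 0 (d m) ≈ 0#
      coeff-g-yᵈ≉0 coeff≈0 = frac≉0 (d m ∸ m₂ m) (d m) 0 (sgn*≢0 (m₃ m) (⟨a₀⟩≢0 (U₂ m))) (begin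
        coeffᵍ 0
          ≈⟨ sym (coeff-mono-≡ _ 0 (d m)) ⟩
        coeff (monomial 0) 0 (d m)
          ≈⟨ sym (∑<-δ (suc (U₂ m)) 0 (s≤s z≤n) others) ⟩
        ∑< (suc (U₂ m)) (λ i → coeff (monomial i) 0 (d m))
          ≈⟨ sym (coeff-∑S (U₂ m) monomial 0 (d m)) ⟩
        coeff (g m) 0 (d m)
          ≈⟨ coeff≈0 ⟩
        0# ∎)
        where
        coeffᵍ : ℕ → Carrier
        coeffᵍ i = frac (sgn (i ℕ.+ m₃ m) ℤ.* ⟨ a₀ m ⟩ (U₂ m ∸ i)) (d m ∸ m₂ m ∸ 2 ℕ.* i) (d m ∸ 2 ℕ.* i) (2 ℕ.* i)
        monomial : ℕ → S
        monomial i = mono (coeffᵍ i) (2 ℕ.* i) (d m ∸ 2 ℕ.* i)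
        others : ∀ i → i < suc (U₂ m) → i ≢ 0 → coeff (monomial i) 0 (d m) ≈ 0#
        others zero    _ 0≢0 = contradiction ≡.refl 0≢0
        others (suc i) _ _   = coeff-mono-≢ (coeffᵍ (suc i)) (2 ℕ.* suc i) (d m ∸ 2 ℕ.* suc i) 0 (d m) (λ ())

      θ∉x·Der : ¬ θ m ∈ xS ·Der
      θ∉x·Der (_ , q₂ , _ , -g≈xq₂) = coeff-g-yᵈ≉0 (-x≈0⇒x≈0 (trans (-g≈xq₂ 0 (d m)) (mulCoeff-x q₂ 0 (d m))))

      θ∉y·Der : ¬ θ m ∈ yS ·Der
      θ∉y·Der (q₁ , _ , f≈yq₁ , _) = coeff-f-xᵈ≉0 (trans (f≈yq₁ (d m) 0) (mulCoeff-y q₁ (d m) 0))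

    module _ (d≡m₂+2U₂ : d m ≡ m₂ m ℕ.+ 2 ℕ.* U₂ m) where

      f-value≉0 : ∀ {t} → t * t ≈ 1# → ¬ degreeValue (d m) t (coeff (f m)) ≈ 0#
      f-value≉0 {t} t²≈1 value≈0 = sgn*≢0 (U₁ m) (⟨+suc⟩≢0 _ (U₁ m)) (ℤ→F≈0⇒≡0 char0 _ (begin
        ℤ→F (sgn (U₁ m) ℤ.* ⟨ + (2 ℕ.+ 2 ℕ.* U₂ m) ⟩ (U₁ m))
          ≡⟨ ≡.cong (λ a → ℤ→F (sgn (U₁ m) ℤ.* ⟨ a ⟩ (U₁ m))) (≡.sym m₁+2-a₀) ⟩
        ℤ→F (sgn (U₁ m) ℤ.* ⟨ + (m₁ m ℕ.+ 2) ℤ.- a₀ m ⟩ (U₁ m))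
          ≈⟨ sym (∑coeffᶠ-closed-form (m₁ m) (U₁ m) (a₀ m) d≡m₁+2U₁) ⟩
        K * ∑< (suc (U₁ m)) (coeffᶠ (d m) (m₁ m) (U₁ m) (a₀ m))
          ≈⟨ *-congˡ (sym (degreeValue-even (d m) (U₁ m) _ t²≈1 2U₁≤d)) ⟩
        K * degreeValue (d m) t (coeff (f m))
          ≈⟨ *-congˡ value≈0 ⟩
        K * 0#
          ≈⟨ zeroʳ K ⟩
        0# ∎))
        where
        K : Carrier
        K = ℕ→F ((2 ℕ.* U₁ m) !! ℕ.* d m !!)
        2U₁≤d : 2 ℕ.* U₁ m ≤ d m
        2U₁≤d = ≡.subst (2 ℕ.* U₁ m ≤_) (≡.sym d≡m₁+2U₁) (ℕₚ.m≤n+m _ (m₁ m))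
        m₁+2-a₀ : + (m₁ m ℕ.+ 2) ℤ.- a₀ m ≡ + (2 ℕ.+ 2 ℕ.* U₂ m)
        m₁+2-a₀ = ≡.subst (λ e → + (m₁ m ℕ.+ 2) ℤ.- (+ (m₁ m ℕ.+ m₂ m) ℤ.- + e) ≡ + (2 ℕ.+ 2 ℕ.* U₂ m)) (≡.sym d≡m₂+2U₂)
                          (+[m₁+2]-[m₁+m₂-d]≡+[2+2n] (m₁ m) (m₂ m) (U₂ m))

      θ∉[x+sy]·Der : ∀ {α s t} → (∀ i j → coeff α i j ≈ coeff xS i j + s * coeff yS i j) →
                     t * s ≈ - 1# → t * t ≈ 1# → ¬ θ m ∈ α ·Der
      θ∉[x+sy]·Der {α} {s} {t} α≈x+sy ts≈-1 t²≈1 (q₁ , _ , f≈αq₁ , _) = f-value≉0 t²≈1 (begin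
        degreeValue (d m) t (coeff (f m))
          ≈⟨ degreeValue-cong (d m) t (λ a b → trans (f≈αq₁ a b) (αq₁≈xq₁+syq₁ a b)) ⟩
        degreeValue (d m) t (λ a b → x*-coeff q₁ a b + s * y*-coeff q₁ a b)
          ≈⟨ degreeValue-x+sy≈0 (d m) q₁ ts≈-1 ⟩
        0# ∎)
        where
        αq₁≈xq₁+syq₁ : ∀ a b → mulCoeff α q₁ a b ≈ x*-coeff q₁ a b + s * y*-coeff q₁ a b
        αq₁≈xq₁+syq₁ a b = trans (mulCoeff-linear {α} {xS} {yS} s q₁ a b α≈x+sy)
                                 (+-cong (mulCoeff-x q₁ a b) (*-congˡ (mulCoeff-y q₁ a b)))

      θ∉[x-y]·Der : ¬ θ m ∈ (xS +S (-S yS)) ·Der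
      θ∉[x-y]·Der = θ∉[x+sy]·Der {xS +S (-S yS)} (λ _ _ → +-congˡ (sym (-1*x≈-x _))) (*-identityˡ (- 1#))
                                 (*-identityˡ 1#)

      θ∉[x+y]·Der : ¬ θ m ∈ (xS +S yS) ·Der
      θ∉[x+y]·Der = θ∉[x+sy]·Der {xS +S yS} (λ _ _ → +-congˡ (sym (*-identityˡ _))) (*-identityʳ (- 1#))
                                 (trans (-1*x≈-x (- 1#)) (-‿involutive 1#))

-- m₄ m ≡ m₃ m is not needed: the coefficients of θ_m involve m₄ only through |m|.
corollary3p6 : ∀ {c ℓ} (F : Field c ℓ) (char0 : CharZero F) (m : Multiplicity) →
    m₄ m ≡ m₃ m → Balanced m → ¬ (2 ∣ m₁ m) → ¬ (2 ∣ m₂ m) → 4 ∣ ∣ m ∣ₘ →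
    (i : Fin 4) → ¬ (Poly._∈_·Der F (Theta.θ F char0 m) (Poly.α F i))
corollary3p6 F char0 m _ balanced m₁-odd m₂-odd 4∣∣m∣ = θ∉αᵢ·Der
  where
  open import Data.Nat using (_+_; _*_)
  open Poly F using (_∈_·Der; α)
  open Theta F char0 using (d; U₁; U₂; θ)
  open ThetaLemmas F char0
  d≡m₁+2U₁ : d m ≡ m₁ m + 2 * U₁ m
  d≡m₁+2U₁ = 4∣n⇒⌊n/2⌋∸1≡odd+even 4∣∣m∣ m₁-odd (balanced Fin.zero)
  d≡m₂+2U₂ : d m ≡ m₂ m + 2 * U₂ m
  d≡m₂+2U₂ = 4∣n⇒⌊n/2⌋∸1≡odd+even 4∣∣m∣ m₂-odd (balanced (Fin.suc Fin.zero))
  θ∉αᵢ·Der : (i : Fin 4) → ¬ θ m ∈ α i ·Der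
  θ∉αᵢ·Der Fin.zero                               = θ∉x·Der m d≡m₁+2U₁ m₂-odd
  θ∉αᵢ·Der (Fin.suc Fin.zero)                     = θ∉y·Der m d≡m₁+2U₁ m₂-odd
  θ∉αᵢ·Der (Fin.suc (Fin.suc Fin.zero))           = θ∉[x-y]·Der m d≡m₁+2U₁ d≡m₂+2U₂
  θ∉αᵢ·Der (Fin.suc (Fin.suc (Fin.suc Fin.zero))) = θ∉[x+y]·Der m d≡m₁+2U₁ d≡m₂+2U₂
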